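{- Let $G$ be a graph on $n$ vertices with maximum degree $\Delta$ and without isolated vertices. Then every critical value of $G$ belongs to the set $\left\{\frac{\Delta+1}{n},\frac{\Delta+2}{n},\dots,\frac{n-1}{n}\right\}$, and $|\mathrm{Sp}^p_\alpha(G)|\le n-\Delta$.
   Context: All graphs are finite and simple. For a graph $G=(V,E)$ and $S\subseteq V$, $N[S]$ denotes the closed neighbourhood of $S$. For $0<\alpha\le 1$, a set $S\subseteq V$ is an $\alpha$-partial dominating set if $|N[S]|\ge \alpha|V|$; $\mathrm{pd}_\alpha(G)$ is the minimum size of an $\alpha$-partial dominating set. The spectrum is $\mathrm{Sp}^p_\alpha(G)=\{\mathrm{pd}_\alpha(G):\alpha\in(0,1]\}$. The function $\alpha\mapsto \mathrm{pd}_\alpha(G)$ is non-decreasing on $(0,1]$; if $\mathrm{Sp}^p_\alpha(G)=\{a_1<\dots<a_t\}$, the critical values are the numbers $\alpha_1<\dots<\alpha_{t-1}$ in $(0,1)$ such that $\mathrm{pd}_\alpha(G)=a_1$ for $\alpha\in(0,\alpha_1]$, $\mathrm{pd}_\alpha(G)=a_{i+1}$ for $\alpha\in(\alpha_i,\alpha_{i+1}]$ ($1\le i\le t-2$), and $\mathrm{pd}_\alpha(G)=a_t$ for $\alpha\in(\alpha_{t-1},1]$ (equivalently, the points $\alpha^*\in(0,1)$ with $\mathrm{pd}_{\alpha^*}(G)<\mathrm{pd}_\beta(G)$ for all $\beta\in(\alpha^*,1]$).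
   Formalization: The parameter α (also in the spectrum $\mathrm{Sp}^p_\alpha(G)$ and in α-partial dominating sets), the critical values and the values β in their definition range over the rationals. -}

module Defs where

open import Data.Nat using (ℕ; zero; suc; _≤_; _<_; _∸_; _+_)
open import Data.Bool using (Bool; true; false; _∨_; _∧_)
open import Data.Fin using (Fin)
open import Data.Fin.Subset using (Subset; ∣_∣; _∈_)
open import Data.Vec using (Vec; tabulate; lookup)
open import Data.Integer using (+_)
open import Data.Rational using (ℚ; _/_; _*_; 0ℚ; 1ℚ) renaming (_≤_ to _≤ℚ_; _<_ to _<ℚ_)
open import Data.Product using (Σ; ∃; _×_)
open import Data.List using (List; length)
open import Data.List.Relation.Unary.All using (All)
open import Data.List.Relation.Unary.Unique.Propositional using (Unique)
open import Relation.Binary.PropositionalEquality using (_≡_)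
open import Relation.Nullary using (¬_)

record Graph (n : ℕ) : Set where
  field
    adj     : Fin n → Fin n → Bool
    adj-sym : ∀ u v → adj u v ≡ adj v u
    irrefl  : ∀ v → adj v v ≡ false
open Graph public

anyFin : ∀ {n} → (Fin n → Bool) → Bool
anyFin {zero}  f = false
anyFin {suc n} f = f Fin.zero ∨ anyFin (λ i → f (Fin.suc i))

nbhd : ∀ {n} → Graph n → Fin n → Subset n
nbhd G v = tabulate (adj G v)

deg : ∀ {n} → Graph n → Fin n → ℕ
deg G v = ∣ nbhd G v ∣

IsMaxDegree : ∀ {n} → Graph n → ℕ → Set
IsMaxDegree G Δ = (∀ v → deg G v ≤ Δ) × ∃ (λ v → deg G v ≡ Δ)

NoIsolated : ∀ {n} → Graph n → Set
NoIsolated G = ∀ v → 1 ≤ deg G v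

closedNbhd : ∀ {n} → Graph n → Subset n → Subset n
closedNbhd G S = tabulate λ v → lookup S v ∨ anyFin (λ u → lookup S u ∧ adj G u v)

IsPartialDom : ∀ {n} → Graph n → ℚ → Subset n → Set
IsPartialDom {n} G α S = α * (+ n / 1) ≤ℚ (+ ∣ closedNbhd G S ∣ / 1)

InUnit : ℚ → Set
InUnit α = (0ℚ <ℚ α) × (α ≤ℚ 1ℚ)

IsPd : ∀ {n} → Graph n → ℚ → ℕ → Set
IsPd G α k =
  Σ _ (λ S → IsPartialDom G α S × ∣ S ∣ ≡ k) ×
  (∀ S → IsPartialDom G α S → k ≤ ∣ S ∣)

InSpectrum : ∀ {n} → Graph n → ℕ → Set
InSpectrum G k = ∃ λ α → InUnit α × IsPd G α k

IsCritical : ∀ {n} → Graph n → ℚ → Set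
IsCritical G a =
  (0ℚ <ℚ a) × (a <ℚ 1ℚ) ×
  (∀ b → a <ℚ b → b ≤ℚ 1ℚ → ∀ k l → IsPd G a k → IsPd G b l → k < l)

SpectrumCardLe : ∀ {n} → Graph n → ℕ → Set
SpectrumCardLe G m = ∀ (xs : List ℕ) → Unique xs → All (InSpectrum G) xs → length xs ≤ m

-- Let G have n + 1 vertices and let v be a vertex of degree Δ; write N[S]
-- for closed neighbourhoods.  Two facts about pd_α carry the proof, and
-- both hold for any vertex v.
--
-- * Range of the spectrum: for 0 < α ≤ 1 we have 1 ≤ pd_α(G) ≤ (n+1) − Δ.
--   Lower bound: α(n+1) > 0 forces N[S] ≠ ∅, hence S ≠ ∅.  Upper bound:
--   V ∖ N(v), which contains v since G is loopless, dominates every vertex.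
--   Distinct spectrum values thus lie in {1, …, (n+1) − Δ}; pigeonhole.
--
-- * Critical values: if α is critical with pd_α = k, then no set T with
--   |T| ≤ k covers m > α(n+1) vertices, for otherwise β = m/(n+1) > α would
--   have pd_β ≤ |T| ≤ k, contradicting criticality.  Taking T a minimum
--   α-partial dominating set gives α(n+1) = |N[T]| =: c; taking T = {v}
--   gives c ≥ Δ + 1; and α < 1 gives c ≤ n.

module Submission where

open import Defs
open import Data.Nat using (ℕ; _≤_; _∸_; _+_)
open import Data.Integer using (+_)
open import Data.Rational using (ℚ; _/_; _*_)
open import Data.Product using (∃; _×_)
open import Relation.Binary.PropositionalEquality using (_≡_)

open import Data.Nat using (suc; _<_; s≤s; z≤n)
import Data.Nat.Properties as ℕP
import Data.Integer as ℤ
import Data.Integer.Properties as ℤP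
open import Data.Rational as ℚ using (mkℚ; 0ℚ; 1ℚ; *≤*; *<*)
import Data.Rational.Properties as ℚP
import Data.Nat.Coprimality as Coprime
open import Relation.Binary.PropositionalEquality
  using (_≢_; refl; sym; trans; cong; cong₂; subst; subst₂; module ≡-Reasoning)
open import Data.Bool using (Bool; true; false; _∨_; _∧_)
import Data.Bool.Properties as BoolP
open import Data.Fin using (Fin)
open import Data.Fin.Subset using (Subset; ∣_∣; _∈_; _∉_; _⊆_; ⁅_⁆; ∁; ⊤; Nonempty)
import Data.Fin.Subset.Properties as SubsetP
open import Data.Vec using (tabulate; lookup)
import Data.Vec.Properties as VecP
open import Data.Product using (Σ; _,_; proj₁; proj₂)
open import Data.Sum using (_⊎_; inj₁; inj₂)
open import Relation.Nullary using (Dec; yes; no; contradiction)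
open import Data.Empty using (⊥)
open import Relation.Nullary.Decidable using (_×-dec_)
open import Data.List using (List; []; _∷_; length; applyUpTo)
import Data.List.Properties as ListP
open import Data.List.Relation.Unary.All using (All; _∷_)
import Data.List.Relation.Unary.All as All
open import Data.List.Relation.Unary.Any using (here; there; index)
open import Data.List.Relation.Unary.AllPairs using (_∷_)
open import Data.List.Relation.Unary.Unique.Propositional using (Unique)
open import Data.List.Membership.Propositional using (_─_) renaming (_∈_ to _∈ₗ_)
open import Data.List.Membership.Propositional.Properties using (∈-applyUpTo⁺)

-- The natural number c as the rational c/1, built directly in lowest terms;
-- the statement's  + c / 1  normalises to it (/1≡ι).
ι : ℕ → ℚ
ι c = mkℚ (+ c) 0 (Coprime.sym (Coprime.1-coprimeTo c))

/1≡ι : ∀ c → + c / 1 ≡ ι c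
/1≡ι c = ℚP.normalize-coprime (Coprime.sym (Coprime.1-coprimeTo c))

ι-mono-≤ : ∀ {c d} → c ≤ d → ι c ℚ.≤ ι d
ι-mono-≤ {c} {d} c≤d =
  *≤* (subst₂ ℤ._≤_ (sym (ℤP.*-identityʳ (+ c))) (sym (ℤP.*-identityʳ (+ d))) (ℤ.+≤+ c≤d))

ι-cancel-≤ : ∀ {c d} → ι c ℚ.≤ ι d → c ≤ d
ι-cancel-≤ {c} {d} (*≤* c≤d) =
  ℤP.drop‿+≤+ (subst₂ ℤ._≤_ (ℤP.*-identityʳ (+ c)) (ℤP.*-identityʳ (+ d)) c≤d)

ι-cancel-< : ∀ {c d} → ι c ℚ.< ι d → c < d
ι-cancel-< {c} {d} (*<* c<d) =
  ℤP.drop‿+<+ (subst₂ ℤ._<_ (ℤP.*-identityʳ (+ c)) (ℤP.*-identityʳ (+ d)) c<d)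

_over_ : ℕ → ℕ → ℚ
m over n = ι m * ℚ.1/ ι (suc n)

over-* : ∀ m n → (m over n) * ι (suc n) ≡ ι m
over-* m n = begin
  (ι m * ℚ.1/ N) * N  ≡⟨ ℚP.*-assoc (ι m) (ℚ.1/ N) N ⟩
  ι m * (ℚ.1/ N * N)  ≡⟨ cong (ι m *_) (ℚP.*-inverseˡ N) ⟩
  ι m * 1ℚ            ≡⟨ ℚP.*-identityʳ (ι m) ⟩
  ι m                 ∎
  where
  open ≡-Reasoning
  N = ι (suc n)

∈-─ : ∀ {A : Set} {x y : A} {ys : List A} (x∈ys : x ∈ₗ ys) → y ∈ₗ ys → x ≢ y → y ∈ₗ ys ─ x∈ys
∈-─ (here refl) (here refl) x≢y = contradiction refl x≢y
∈-─ (here refl) (there y∈ys) _  = y∈ys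
∈-─ (there x∈ys) (here y≡z) _   = here y≡z
∈-─ (there x∈ys) (there y∈ys) x≢y = there (∈-─ x∈ys y∈ys x≢y)

unique-length-≤ : ∀ {A : Set} {xs ys : List A} → Unique xs → All (_∈ₗ ys) xs → length xs ≤ length ys
unique-length-≤ {xs = []} _ _ = z≤n
unique-length-≤ {xs = x ∷ xs} {ys} (x≢xs ∷ unique) (x∈ys ∷ xs⊆ys) = begin
  suc (length xs)          ≤⟨ s≤s (unique-length-≤ unique xs⊆ys─x) ⟩
  suc (length (ys ─ x∈ys)) ≡⟨ sym (ListP.length-removeAt′ ys (index x∈ys)) ⟩
  length ys                ∎
  where
  open ℕP.≤-Reasoning
  xs⊆ys─x : All (_∈ₗ ys ─ x∈ys) xs
  xs⊆ys─x = All.zipWith (λ (x≢y , y∈ys) → ∈-─ x∈ys y∈ys x≢y) (x≢xs , xs⊆ys)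

bounded-unique-length : ∀ {m} {xs : List ℕ} → Unique xs → All (λ s → 1 ≤ s × s ≤ m) xs → length xs ≤ m
bounded-unique-length {m} unique inRange =
  subst (_ ≤_) (ListP.length-applyUpTo suc m)
    (unique-length-≤ unique (All.map (λ (1≤s , s≤m) → ∈-interval 1≤s s≤m) inRange))
  where
  ∈-interval : ∀ {s} → 1 ≤ s → s ≤ m → s ∈ₗ applyUpTo suc m
  ∈-interval {0} () _
  ∈-interval {suc i} _ i<m = ∈-applyUpTo⁺ suc i<m

nonempty⇒size : ∀ {n} {p : Subset n} → Nonempty p → 1 ≤ ∣ p ∣
nonempty⇒size (x , x∈p) = ℕP.≤-trans (s≤s z≤n) (SubsetP.x∈p⇒∣p-x∣<∣p∣ x∈p)

size⇒nonempty : ∀ {n} {p : Subset n} → 0 < ∣ p ∣ → Nonempty p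
size⇒nonempty {n} {p} 0<∣p∣ with SubsetP.nonempty? p
... | yes nonempty = nonempty
... | no empty =
  contradiction (subst (0 <_) (SubsetP.∣⊥∣≡0 n) (subst (λ q → 0 < ∣ q ∣) (SubsetP.Empty-unique empty) 0<∣p∣))
    (ℕP.<-irrefl refl)

IsMinimumSize : ∀ {n} → (Subset n → Set) → ℕ → Set
IsMinimumSize {n} P k = Σ (Subset n) (λ S → P S × ∣ S ∣ ≡ k) × (∀ S → P S → k ≤ ∣ S ∣)

minimum-exists : ∀ {n} (P : Subset n → Set) → (∀ S → Dec (P S)) → ∀ S → P S → Σ ℕ (IsMinimumSize P)
minimum-exists P P? S pS = search ∣ S ∣ S pS ℕP.≤-refl
  where
  search : ∀ b S → P S → ∣ S ∣ ≤ b → Σ ℕ (IsMinimumSize P)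
  search 0 S pS S≤0 = ∣ S ∣ , (S , pS , refl) , λ _ _ → ℕP.≤-trans S≤0 z≤n
  search (suc b) S pS S≤b+1 with SubsetP.anySubset? (λ T → P? T ×-dec (∣ T ∣ ℕP.≤? b))
  ... | yes (T , pT , T≤b) = search b T pT T≤b
  ... | no noSmaller =
    ∣ S ∣ , (S , pS , refl) , λ T pT → ℕP.≤-trans S≤b+1 (ℕP.≰⇒> λ T≤b → noSmaller (T , pT , T≤b))

∨-true : ∀ a b → a ∨ b ≡ true → a ≡ true ⊎ b ≡ true
∨-true true _ _ = inj₁ refl
∨-true false _ b = inj₂ b

anyFin-intro : ∀ {n} (f : Fin n → Bool) u → f u ≡ true → anyFin f ≡ true
anyFin-intro f Fin.zero fu rewrite fu = refl
anyFin-intro f (Fin.suc u) fu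
  rewrite anyFin-intro (λ i → f (Fin.suc i)) u fu = BoolP.∨-zeroʳ (f Fin.zero)

anyFin-elim : ∀ {n} (f : Fin n → Bool) → anyFin f ≡ true → Σ (Fin n) λ u → f u ≡ true
anyFin-elim {0} f ()
anyFin-elim {suc n} f any with f Fin.zero in f0
... | true = Fin.zero , f0
... | false with anyFin-elim (λ i → f (Fin.suc i)) any
...   | u , fu = Fin.suc u , fu

∈-tabulate⁺ : ∀ {n} {f : Fin n → Bool} {x} → f x ≡ true → x ∈ tabulate f
∈-tabulate⁺ {f = f} {x} fx = VecP.lookup⇒[]= x (tabulate f) (trans (VecP.lookup∘tabulate f x) fx)

∈-tabulate⁻ : ∀ {n} {f : Fin n → Bool} {x} → x ∈ tabulate f → f x ≡ true
∈-tabulate⁻ {f = f} {x} x∈ = trans (sym (VecP.lookup∘tabulate f x)) (VecP.[]=⇒lookup x∈)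

module Neighbourhoods {n : ℕ} (G : Graph n) where

  ∈-nbhd⁻ : ∀ {v x} → x ∈ nbhd G v → adj G v x ≡ true
  ∈-nbhd⁻ = ∈-tabulate⁻

  ∉-nbhd-self : ∀ v → v ∉ nbhd G v
  ∉-nbhd-self v v∈Nv with trans (sym (∈-nbhd⁻ v∈Nv)) (irrefl G v)
  ... | ()

  hasNbrIn : Subset n → Fin n → Bool
  hasNbrIn S x = anyFin (λ u → lookup S u ∧ adj G u x)

  ∈-closedNbhd-self : ∀ {S x} → x ∈ S → x ∈ closedNbhd G S
  ∈-closedNbhd-self {S} {x} x∈S = ∈-tabulate⁺ (cong (_∨ hasNbrIn S x) (VecP.[]=⇒lookup x∈S))

  ∈-closedNbhd-adj : ∀ {S u x} → u ∈ S → adj G u x ≡ true → x ∈ closedNbhd G S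
  ∈-closedNbhd-adj {S} {u} {x} u∈S ux =
    ∈-tabulate⁺ (trans (cong (lookup S x ∨_) (anyFin-intro _ u u∈S∧ux)) (BoolP.∨-zeroʳ _))
    where
    u∈S∧ux : lookup S u ∧ adj G u x ≡ true
    u∈S∧ux = cong₂ _∧_ (VecP.[]=⇒lookup u∈S) ux

  closedNbhd-nonempty : ∀ {S} → Nonempty (closedNbhd G S) → Nonempty S
  closedNbhd-nonempty {S} (x , x∈NS) with ∨-true (lookup S x) (hasNbrIn S x) (∈-tabulate⁻ x∈NS)
  ... | inj₁ Sx = x , VecP.lookup⇒[]= x S Sx
  ... | inj₂ adjacent with anyFin-elim _ adjacent
  ...   | u , Su∧ux = u , VecP.lookup⇒[]= u S (BoolP.∧-conicalˡ _ _ Su∧ux)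

  -- N[{v}] contains N(v) and v itself, so |N[{v}]| ≥ deg v + 1.
  closedNbhd-singleton : ∀ v → suc (deg G v) ≤ ∣ closedNbhd G ⁅ v ⁆ ∣
  closedNbhd-singleton v = SubsetP.p⊂q⇒∣p∣<∣q∣ (Nv⊆ , v , v∈ , ∉-nbhd-self v)
    where
    Nv⊆ : nbhd G v ⊆ closedNbhd G ⁅ v ⁆
    Nv⊆ x∈Nv = ∈-closedNbhd-adj (SubsetP.x∈⁅x⁆ v) (∈-nbhd⁻ x∈Nv)
    v∈ : v ∈ closedNbhd G ⁅ v ⁆
    v∈ = ∈-closedNbhd-self (SubsetP.x∈⁅x⁆ v)

  -- V ∖ N(v) dominates G: it contains v, and v covers every neighbour.
  nonNbhd-dominates : ∀ v x → x ∈ closedNbhd G (∁ (nbhd G v))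
  nonNbhd-dominates v x with x SubsetP.∈? nbhd G v
  ... | yes x∈Nv = ∈-closedNbhd-adj (SubsetP.x∉p⇒x∈∁p (∉-nbhd-self v)) (∈-nbhd⁻ x∈Nv)
  ... | no x∉Nv = ∈-closedNbhd-self (SubsetP.x∉p⇒x∈∁p x∉Nv)

module PartialDomination {n : ℕ} (G : Graph (suc n)) where
  open Neighbourhoods G

  N : ℚ
  N = ι (suc n)

  partialDom⁻ : ∀ {α} S → IsPartialDom G α S → α * N ℚ.≤ ι ∣ closedNbhd G S ∣
  partialDom⁻ {α} S = subst₂ ℚ._≤_ (cong (α *_) (/1≡ι (suc n))) (/1≡ι _)

  partialDom⁺ : ∀ {α} S → α * N ℚ.≤ ι ∣ closedNbhd G S ∣ → IsPartialDom G α S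
  partialDom⁺ {α} S = subst₂ ℚ._≤_ (cong (α *_) (sym (/1≡ι (suc n)))) (sym (/1≡ι _))

  dominating⇒partialDom : ∀ {α} S → (∀ x → x ∈ closedNbhd G S) → α ℚ.≤ 1ℚ → IsPartialDom G α S
  dominating⇒partialDom {α} S dominates α≤1 = partialDom⁺ {α} S (begin
    α * N                   ≤⟨ ℚP.*-monoʳ-≤-nonNeg N α≤1 ⟩
    1ℚ * N                  ≡⟨ ℚP.*-identityˡ N ⟩
    N                       ≤⟨ ι-mono-≤ n+1≤∣NS∣ ⟩
    ι ∣ closedNbhd G S ∣    ∎)
    where
    open ℚP.≤-Reasoning
    n+1≤∣NS∣ : suc n ≤ ∣ closedNbhd G S ∣
    n+1≤∣NS∣ = subst (_≤ ∣ closedNbhd G S ∣) (SubsetP.∣⊤∣≡n (suc n))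
      (SubsetP.p⊆q⇒∣p∣≤∣q∣ {p = ⊤} (λ {x} _ → dominates x))

  pd-exists : ∀ {α} S → IsPartialDom G α S → Σ ℕ (IsPd G α)
  pd-exists {α} = minimum-exists (IsPartialDom G α) (λ S → _ ℚP.≤? _)

  pd-positive : ∀ {α} S → 0ℚ ℚ.< α → IsPartialDom G α S → 1 ≤ ∣ S ∣
  pd-positive {α} S 0<α pS =
    nonempty⇒size (closedNbhd-nonempty {S} (size⇒nonempty (ι-cancel-< (ℚP.<-≤-trans 0<αN (partialDom⁻ {α} S pS)))))
    where
    0<αN : ι 0 ℚ.< α * N
    0<αN = subst (ℚ._< α * N) (ℚP.*-zeroˡ N) (ℚP.*-monoˡ-<-pos N 0<α)

  spectrum-bounds : ∀ v {s} → InSpectrum G s → 1 ≤ s × s ≤ suc n ∸ deg G v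
  spectrum-bounds v (α , (0<α , α≤1) , (S , pS , refl) , minimal) =
    pd-positive S 0<α pS ,
    subst (_ ≤_) (SubsetP.∣∁p∣≡n∸∣p∣ (nbhd G v))
      (minimal (∁ (nbhd G v)) (dominating⇒partialDom (∁ (nbhd G v)) (nonNbhd-dominates v) α≤1))

  -- At a critical value α with pd_α = k, a set of at most k vertices covers
  -- at most α(n+1) vertices: covering m > α(n+1) would make β = m/(n+1) > α
  -- satisfy pd_β ≤ k.
  critical-coverage-bound : ∀ {α k} → IsCritical G α → IsPd G α k →
    ∀ m T → ∣ T ∣ ≤ k → m ≤ ∣ closedNbhd G T ∣ → ι m ℚ.≤ α * N
  critical-coverage-bound {α} {k} (_ , _ , critical) pdα m T T≤k m≤NT = ℚP.≮⇒≥ better⇒contradiction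
    where
    β : ℚ
    β = m over n
    βN≡m : β * N ≡ ι m
    βN≡m = over-* m n
    β≤1 : β ℚ.≤ 1ℚ
    β≤1 = ℚP.*-cancelʳ-≤-pos N (subst₂ ℚ._≤_ (sym βN≡m) (sym (ℚP.*-identityˡ N))
            (ι-mono-≤ (ℕP.≤-trans m≤NT (SubsetP.∣p∣≤n (closedNbhd G T)))))
    pT : IsPartialDom G β T
    pT = partialDom⁺ {β} T (subst (ℚ._≤ ι ∣ closedNbhd G T ∣) (sym βN≡m) (ι-mono-≤ m≤NT))
    pdβ : Σ ℕ (IsPd G β)
    pdβ = pd-exists {β} T pT
    better⇒contradiction : α * N ℚ.< ι m → ⊥
    better⇒contradiction αN<m = ℕP.<-irrefl refl (begin-strict
      k               <⟨ critical β α<β β≤1 k (proj₁ pdβ) pdα (proj₂ pdβ) ⟩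
      proj₁ pdβ       ≤⟨ proj₂ (proj₂ pdβ) T pT ⟩
      ∣ T ∣           ≤⟨ T≤k ⟩
      k               ∎)
      where
      open ℕP.≤-Reasoning
      α<β : α ℚ.< β
      α<β = ℚP.*-cancelʳ-<-nonNeg N (subst (α * N ℚ.<_) (sym βN≡m) αN<m)

  critical-value-range : ∀ {α} → IsCritical G α → ∀ v →
    ∃ λ c → (suc (deg G v) ≤ c) × (c ≤ n) × (α * N ≡ ι c)
  critical-value-range {α} isCritical@(0<α , α<1 , _) v = from-pd (pd-exists {α} V∖Nv pV∖Nv)
    where
    V∖Nv : Subset (suc n)
    V∖Nv = ∁ (nbhd G v)
    pV∖Nv : IsPartialDom G α V∖Nv
    pV∖Nv = dominating⇒partialDom {α} V∖Nv (nonNbhd-dominates v) (ℚP.<⇒≤ α<1)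

    from-pd : Σ ℕ (IsPd G α) → ∃ λ c → (suc (deg G v) ≤ c) × (c ≤ n) × (α * N ≡ ι c)
    from-pd (k , pdα@((S , pS , ∣S∣≡k) , _)) = c , deg<c , c≤n , αN≡c
      where
      c : ℕ
      c = ∣ closedNbhd G S ∣
      αN≡c : α * N ≡ ι c
      αN≡c = ℚP.≤-antisym (partialDom⁻ {α} S pS)
        (critical-coverage-bound isCritical pdα c S (ℕP.≤-reflexive ∣S∣≡k) ℕP.≤-refl)
      c≤n : c ≤ n
      c≤n = ℕP.≤-pred (ι-cancel-< (subst₂ ℚ._<_ αN≡c (ℚP.*-identityˡ N) (ℚP.*-monoˡ-<-pos N α<1)))
      ∣v∣≤k : ∣ ⁅ v ⁆ ∣ ≤ k
      ∣v∣≤k = subst₂ _≤_ (sym (SubsetP.∣⁅x⁆∣≡1 v)) ∣S∣≡k (pd-positive {α} S 0<α pS)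
      deg<c : suc (deg G v) ≤ c
      deg<c = ι-cancel-≤ (subst (ι (suc (deg G v)) ℚ.≤_) αN≡c
        (critical-coverage-bound isCritical pdα (suc (deg G v)) ⁅ v ⁆ ∣v∣≤k (closedNbhd-singleton v)))

mainTheorem18 : (n : ℕ) (G : Graph n) (Δ : ℕ) → IsMaxDegree G Δ → NoIsolated G →
    ((α : ℚ) → IsCritical G α →
      ∃ λ k → (Δ + 1 ≤ k) × (k ≤ n ∸ 1) × (α * (+ n / 1) ≡ + k / 1))
    × SpectrumCardLe G (n ∸ Δ)
mainTheorem18 0 G Δ (_ , () , _) _
mainTheorem18 (suc n) G Δ (_ , v , degv≡Δ) _ = criticalValues , spectrumSize
  where
  open PartialDomination G

  criticalValues : (α : ℚ) → IsCritical G α →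
    ∃ λ k → (Δ + 1 ≤ k) × (k ≤ n) × (α * (+ suc n / 1) ≡ + k / 1)
  criticalValues α isCritical = fraction (critical-value-range {α} isCritical v)
    where
    open ≡-Reasoning
    fraction : ∃ (λ c → (suc (deg G v) ≤ c) × (c ≤ n) × (α * N ≡ ι c)) →
      ∃ λ k → (Δ + 1 ≤ k) × (k ≤ n) × (α * (+ suc n / 1) ≡ + k / 1)
    fraction (c , deg<c , c≤n , αN≡c) = c , Δ+1≤c , c≤n , αN≡c/1
      where
      Δ+1≤c : Δ + 1 ≤ c
      Δ+1≤c = subst (_≤ c) (trans (cong suc degv≡Δ) (ℕP.+-comm 1 Δ)) deg<c
      αN≡c/1 : α * (+ suc n / 1) ≡ + c / 1
      αN≡c/1 = begin
        α * (+ suc n / 1)  ≡⟨ cong (α *_) (/1≡ι (suc n)) ⟩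
        α * N              ≡⟨ αN≡c ⟩
        ι c                ≡⟨ sym (/1≡ι c) ⟩
        + c / 1            ∎

  spectrumSize : SpectrumCardLe G (suc n ∸ Δ)
  spectrumSize xs unique inSpectrum = bounded-unique-length unique (All.map inRange inSpectrum)
    where
    inRange : ∀ {s} → InSpectrum G s → 1 ≤ s × s ≤ suc n ∸ Δ
    inRange sp = subst (λ d → 1 ≤ _ × _ ≤ suc n ∸ d) degv≡Δ (spectrum-bounds v sp)
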